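{- Let $n\ge 2$ and let $\pi\in S_n$ end in an ascent, i.e. $\pi(n-1)<\pi(n)$. Let $\pi'=\mathrm{st}(\pi(1)\cdots\pi(n-1))\in S_{n-1}$ be the permutation obtained by removing the last letter of $\pi$ (and standardizing). Then $w(\pi')=w(\pi)$.
   Context: For a word $\sigma$ of distinct positive integers, $\mathrm{des}(\sigma)$ is its number of descents (adjacent positions $i$ with $\sigma_i>\sigma_{i+1}$) and $\mathrm{st}(\sigma)$ is its standardization (replace the $j$-th smallest letter by $j$), a permutation. The weight $w\colon S_n\to\mathbb Z_{\ge0}$ is defined recursively: if $\pi$ is the identity $12\cdots n$ or the decreasing permutation $n(n-1)\cdots1$, then $w(\pi)=0$. Otherwise form the word $\pi(1)\cdots\pi(n)(n+1)$ and write it as $\pi_L\cdot 1\cdot\pi_R$, where $\pi_L$ is the (possibly empty) subword left of the letter $1$ and $\pi_R$ the subword right of $1$ (ending in $n+1$). Decompose $\pi_L=\pi_1\cdots\pi_l$: $\pi_1$ is the prefix of $\pi_L$ ending at its largest letter, $\pi_2$ the prefix of the remaining word ending at its largest letter, and so on. Then $w(\pi)=w(\mathrm{st}(\pi_R))+\mathrm{des}(\pi_R)+\sum_{i=1}^{l}\bigl(w(\mathrm{st}(\pi_i))+\mathrm{des}(\pi_i)\bigr)$. -}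

module Defs where

open import Data.Nat using (ℕ; zero; suc; _+_; _*_; _<ᵇ_; _≡ᵇ_; _⊔_)
open import Data.Bool using (Bool; true; false; if_then_else_; _∨_)
open import Data.List using (List; []; _∷_; _++_; map; length; upTo; reverse; foldr)
open import Data.Nat.ListAction using (sum)
open import Data.Product using (_×_; _,_)

idWord : ℕ → List ℕ
idWord n = map suc (upTo n)

countBelow : ℕ → List ℕ → ℕ
countBelow x [] = 0
countBelow x (y ∷ ys) = (if y <ᵇ x then 1 else 0) + countBelow x ys

-- standardization: replace the j-th smallest letter by j
-- (for words of distinct letters, the letter x becomes 1 + #{letters < x})
st : List ℕ → List ℕ
st σ = map (λ x → suc (countBelow x σ)) σ

des : List ℕ → ℕ
des [] = 0
des (x ∷ []) = 0
des (x ∷ y ∷ ys) = (if y <ᵇ x then 1 else 0) + des (y ∷ ys)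

eqList : List ℕ → List ℕ → Bool
eqList [] [] = true
eqList (x ∷ xs) (y ∷ ys) = if x ≡ᵇ y then eqList xs ys else false
eqList _ _ = false

maxList : List ℕ → ℕ
maxList = foldr _⊔_ 0

splitAt1st : ℕ → List ℕ → List ℕ × List ℕ
splitAt1st x [] = [] , []
splitAt1st x (y ∷ ys) with x ≡ᵇ y
... | true  = [] , ys
... | false with splitAt1st x ys
...   | (l , r) = y ∷ l , r

prefixTo : ℕ → List ℕ → List ℕ × List ℕ
prefixTo x [] = [] , []
prefixTo x (y ∷ ys) with x ≡ᵇ y
... | true  = y ∷ [] , ys
... | false with prefixTo x ys
...   | (l , r) = y ∷ l , r

-- decomposition π_L = π_1 ⋯ π_l : π_1 is the prefix ending at the largest
-- letter, π_2 the prefix of the rest ending at its largest letter, etc.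
-- (fuel = length suffices, since every block is non-empty)
blocksF : ℕ → List ℕ → List (List ℕ)
blocksF zero _ = []
blocksF (suc k) [] = []
blocksF (suc k) (y ∷ ys) with prefixTo (maxList (y ∷ ys)) (y ∷ ys)
... | (b , rest) = b ∷ blocksF k rest

blocks : List ℕ → List (List ℕ)
blocks σ = blocksF (length σ) σ

-- The recursion is well founded, but a recursive
-- call may be on a permutation of the same length (when π(1) = 1), so we
-- use fuel; (n+1)*(n+1) steps are more than enough.
wF : ℕ → List ℕ → ℕ
wF zero π = 0
wF (suc k) π =
  if eqList π (idWord n) ∨ eqList π (reverse (idWord n))
  then 0
  else (wF k (st πR) + des πR + sum (map (λ b → wF k (st b) + des b) (blocks πL)))
  where
  n : ℕ
  n = length π
  parts : List ℕ × List ℕ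
  parts = splitAt1st 1 (π ++ suc n ∷ [])
  πL : List ℕ
  πL = Data.Product.proj₁ parts
  πR : List ℕ
  πR = Data.Product.proj₂ parts

-- the weight w(π) of a permutation π ∈ S_n given as the word π(1)⋯π(n)
w : List ℕ → ℕ
w π = wF (suc (length π) * suc (length π)) π

-- Write π = x c with x ending in a letter a < c.  The letter 1 lies in x, say x = L 1 R, and
-- standardizing x relabels it by the strictly increasing map rank x, which fixes 1 and changes
-- neither standardizations, descent numbers nor block decompositions.  So the recursion splits
-- π and st x at 1 into left parts with equal block sums and right parts R c (n+1) and
-- (rank x R) n.  By induction along the recursion, deleting a final ascent does not change the
-- weight of the standardization, so both right parts contribute exactly what R does.  The
-- trivial cases match: π is increasing iff x is, π is never decreasing, and a decreasing st x
-- also gets weight 0 from the recursion.  Finally, w runs on fuel (n+1)²; the fuel only has to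
-- exceed a measure that decreases along the recursion, so the different fuels spent on π and on
-- st x give the same values.

module Submission where

open import Defs
open import Data.Bool using (Bool; true; false; if_then_else_; _∨_; T)
open import Data.Bool.Properties using (T-≡)
open import Data.List using (List; []; _∷_; _++_; _∷ʳ_; [_]; map; length; upTo; reverse; _∷ʳ′_; initLast)
open import Data.List.Properties
  using (∷-injectiveˡ; ∷-injectiveʳ; ∷ʳ-injective; ++-assoc; length-++; length-map; length-upTo;
         map-++; map-∘; map-cong; map-cong-local; map-id; map-id-local; map-upTo; reverse-map; reverse-upTo)
open import Data.List.Extrema.Nat using (min; argmin-all; min≤⊤; min≤xs)
open import Data.List.Membership.Propositional using (_∈_; _∉_)
open import Data.List.Membership.Propositional.Properties using (∈-map⁺; ∈-map⁻; ∈-++⁺ˡ; ∈-++⁺ʳ; ∈-++⁻; ∈-∃++)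
open import Data.List.Relation.Binary.Subset.Propositional using (_⊆_)
open import Data.List.Relation.Binary.Permutation.Propositional using (_↭_; ↭-sym; ↭⇒↭ₛ)
import Data.List.Relation.Binary.Permutation.Propositional.Properties as ↭
open import Data.List.Relation.Unary.Any using (here; there)
open import Data.List.Relation.Unary.All as All using (All; []; _∷_)
import Data.List.Relation.Unary.All.Properties as All
open import Data.List.Relation.Unary.AllPairs as AllPairs using (AllPairs; []; _∷_)
import Data.List.Relation.Unary.AllPairs.Properties as AllPairs
open import Data.List.Relation.Unary.Unique.Propositional using (Unique)
import Data.List.Relation.Unary.Unique.Propositional.Properties as Unique
open import Data.Nat using (ℕ; zero; suc; pred; _+_; _*_; _∸_; _≤_; _<_; _>_; _≮_; z≤n; s≤s; z<s; _<ᵇ_; _≡ᵇ_; _<?_)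
open import Data.Nat.ListAction using (sum)
open import Data.Nat.ListAction.Properties using (sum-↭)
open import Data.Nat.Properties
open import Data.Product as Product using (_×_; _,_; proj₁; proj₂; ∃₂)
open import Data.Sum using (inj₁; inj₂)
open import Data.Unit using (tt)
open import Function using (_∘_; id; _⇔_; mk⇔; Equivalence)
open import Function.Construct.Composition using (_⇔-∘_)
open import Function.Construct.Symmetry using (⇔-sym)
open import Relation.Binary.Definitions using (tri<; tri≈; tri>)
open import Relation.Binary.PropositionalEquality hiding ([_])
open import Data.List.Relation.Binary.Permutation.Setoid.Properties (setoid ℕ) using (Unique-resp-↭)
open import Relation.Nullary using (contradiction; yes; no)
open import Relation.Nullary.Reflects using (Reflects; ofʸ; ofⁿ; fromEquivalence)

open Equivalence using (to; from)

indicator : Bool → ℕ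
indicator b = if b then 1 else 0

≡ᵇ-reflects-≡ : ∀ m n → Reflects (m ≡ n) (m ≡ᵇ n)
≡ᵇ-reflects-≡ m n = fromEquivalence (≡ᵇ⇒≡ m n) (≡⇒≡ᵇ m n)

<ᵇ-true : ∀ {m n} → m < n → (m <ᵇ n) ≡ true
<ᵇ-true {m} {n} m<n with m <ᵇ n | <ᵇ-reflects-< m n
... | true  | _       = refl
... | false | ofⁿ m≮n = contradiction m<n m≮n

<ᵇ-false : ∀ {m n} → m ≮ n → (m <ᵇ n) ≡ false
<ᵇ-false {m} {n} m≮n with m <ᵇ n | <ᵇ-reflects-< m n
... | false | _       = refl
... | true  | ofʸ m<n = contradiction m<n m≮n

≡ᵇ-true : ∀ {m n} → m ≡ n → (m ≡ᵇ n) ≡ true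
≡ᵇ-true {m} {n} m≡n with m ≡ᵇ n | ≡ᵇ-reflects-≡ m n
... | true  | _       = refl
... | false | ofⁿ m≢n = contradiction m≡n m≢n

≡ᵇ-false : ∀ {m n} → m ≢ n → (m ≡ᵇ n) ≡ false
≡ᵇ-false {m} {n} m≢n with m ≡ᵇ n | ≡ᵇ-reflects-≡ m n
... | false | _       = refl
... | true  | ofʸ m≡n = contradiction m≡n m≢n

Reflects-cong : ∀ {A B : Set} {a b} → Reflects A a → Reflects B b → A ⇔ B → a ≡ b
Reflects-cong (ofʸ _) (ofʸ _) _   = refl
Reflects-cong (ofⁿ _) (ofⁿ _) _   = refl
Reflects-cong (ofʸ x) (ofⁿ ¬y) eq = contradiction (to eq x) ¬y
Reflects-cong (ofⁿ ¬x) (ofʸ y) eq = contradiction (from eq y) ¬x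

<ᵇ-cong : ∀ {m n m′ n′} → m < n ⇔ m′ < n′ → (m <ᵇ n) ≡ (m′ <ᵇ n′)
<ᵇ-cong {m} {n} {m′} {n′} = Reflects-cong (<ᵇ-reflects-< m n) (<ᵇ-reflects-< m′ n′)

≡ᵇ-cong : ∀ {m n m′ n′} → m ≡ n ⇔ m′ ≡ n′ → (m ≡ᵇ n) ≡ (m′ ≡ᵇ n′)
≡ᵇ-cong {m} {n} {m′} {n′} = Reflects-cong (≡ᵇ-reflects-≡ m n) (≡ᵇ-reflects-≡ m′ n′)

n<ᵇn≡false : ∀ n → (n <ᵇ n) ≡ false
n<ᵇn≡false n = <ᵇ-false {n} (<-irrefl refl)

indicator-<ᵇ-mono : ∀ z {u v} → u ≤ v → indicator (z <ᵇ u) ≤ indicator (z <ᵇ v)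
indicator-<ᵇ-mono z {u} {v} u≤v with z <ᵇ u | <ᵇ-reflects-< z u | z <ᵇ v | <ᵇ-reflects-< z v
... | false | _       | _     | _       = z≤n
... | true  | _       | true  | _       = ≤-refl
... | true  | ofʸ z<u | false | ofⁿ z≮v = contradiction (<-≤-trans z<u u≤v) z≮v

if-∨-cong : ∀ {p p′ q q′ : Bool} {r r′ : ℕ} → p ≡ p′ → q′ ≡ false → (T q → r ≡ 0) → r ≡ r′ →
            (if p ∨ q then 0 else r) ≡ (if p′ ∨ q′ then 0 else r′)
if-∨-cong {true}              refl refl _   _    = refl
if-∨-cong {false} {q = true}  refl refl r≡0 r≡r′ = trans (sym (r≡0 tt)) r≡r′
if-∨-cong {false} {q = false} refl refl _   r≡r′ = r≡r′

if-∨-congʳ : ∀ {p q : Bool} {r r′ : ℕ} → (p ≡ false → r ≡ r′) → (if p ∨ q then 0 else r) ≡ (if p ∨ q then 0 else r′)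
if-∨-congʳ {true}             _    = refl
if-∨-congʳ {false} {true}     _    = refl
if-∨-congʳ {false} {false} r≡r′ = r≡r′ refl

AllPairs-++⁻ˡ : ∀ {A : Set} {R : A → A → Set} xs {ys} → AllPairs R (xs ++ ys) → AllPairs R xs
AllPairs-++⁻ˡ []       _         = []
AllPairs-++⁻ˡ (x ∷ xs) (Rx ∷ Rs) = All.++⁻ˡ xs Rx ∷ AllPairs-++⁻ˡ xs Rs

AllPairs-++⁻ʳ : ∀ {A : Set} {R : A → A → Set} xs {ys} → AllPairs R (xs ++ ys) → AllPairs R ys
AllPairs-++⁻ʳ []       Rs       = Rs
AllPairs-++⁻ʳ (x ∷ xs) (_ ∷ Rs) = AllPairs-++⁻ʳ xs Rs

AllPairs-∷ʳ⁻ : ∀ {A : Set} {R : A → A → Set} s {d} → AllPairs R (s ∷ʳ d) → All (λ z → R z d) s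
AllPairs-∷ʳ⁻ []      _          = []
AllPairs-∷ʳ⁻ (x ∷ s) (Rx ∷ Rs) = All.lookup Rx (∈-++⁺ʳ s (here refl)) ∷ AllPairs-∷ʳ⁻ s Rs

Unique-∷ʳ : ∀ {A : Set} {xs : List A} {c} → Unique xs → c ∉ xs → Unique (xs ∷ʳ c)
Unique-∷ʳ uniq c∉xs =
  AllPairs.++⁺ uniq ([] ∷ []) (All.tabulate λ v∈xs → (λ { refl → c∉xs v∈xs }) ∷ [])

Unique-∉-prefix : ∀ {A : Set} xs {c : A} {ys} → Unique (xs ++ c ∷ ys) → c ∉ xs
Unique-∉-prefix (x ∷ xs) (x≢ ∷ _)    (here refl) = All.lookup x≢ (∈-++⁺ʳ xs (here refl)) refl
Unique-∉-prefix (x ∷ xs) (_  ∷ uniq) (there c∈)  = Unique-∉-prefix xs uniq c∈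

Unique-split : ∀ {A : Set} {c : A} {xs} → Unique xs → c ∈ xs → ∃₂ λ L R → xs ≡ L ++ c ∷ R × c ∉ L
Unique-split uniq c∈ with ∈-∃++ c∈
... | L , R , refl = L , R , refl , Unique-∉-prefix L uniq

map-fixed : ∀ {A : Set} {f : A → A} {xs} → map f xs ≡ xs → ∀ {u} → u ∈ xs → f u ≡ u
map-fixed {xs = x ∷ xs} eq (here refl) = ∷-injectiveˡ eq
map-fixed {xs = x ∷ xs} eq (there u∈) = map-fixed (∷-injectiveʳ eq) u∈

eqList-sound : ∀ xs ys → T (eqList xs ys) → xs ≡ ys
eqList-sound []       []       _ = refl
eqList-sound (x ∷ xs) (y ∷ ys) t with x ≡ᵇ y | ≡ᵇ-reflects-≡ x y
... | true  | ofʸ refl = cong (x ∷_) (eqList-sound xs ys t)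

eqList-refl : ∀ xs → T (eqList xs xs)
eqList-refl []       = tt
eqList-refl (x ∷ xs) rewrite ≡ᵇ-true {x} refl = eqList-refl xs

splitAt1st-∉ : ∀ {c} L {R} → c ∉ L → splitAt1st c (L ++ c ∷ R) ≡ (L , R)
splitAt1st-∉ {c} []      c∉ rewrite ≡ᵇ-true {c} refl = refl
splitAt1st-∉ {c} (x ∷ L) c∉ rewrite ≡ᵇ-false {c} {x} (c∉ ∘ here) =
  cong (Product.map₁ (x ∷_)) (splitAt1st-∉ L (c∉ ∘ there))

prefixTo-++ : ∀ m xs → proj₁ (prefixTo m xs) ++ proj₂ (prefixTo m xs) ≡ xs
prefixTo-++ m []       = refl
prefixTo-++ m (x ∷ xs) with m ≡ᵇ x
... | true  = refl
... | false = cong (x ∷_) (prefixTo-++ m xs)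

LastBelow : ℕ → List ℕ → Set
LastBelow c u = ∀ s d → u ≡ s ∷ʳ d → d < c

LastBelow-∷ʳ : ∀ {c s d} → d < c → LastBelow c (s ∷ʳ d)
LastBelow-∷ʳ {c} {s} d<c s′ d′ eq = subst (_< c) (proj₂ (∷ʳ-injective s s′ eq)) d<c

LastBelow-++⁻ʳ : ∀ {c} xs {ys} → LastBelow c (xs ++ ys) → LastBelow c ys
LastBelow-++⁻ʳ xs lb s d refl = lb (xs ++ s) d (sym (++-assoc xs s [ d ]))

All⇒LastBelow : ∀ {c u} → All (_< c) u → LastBelow c u
All⇒LastBelow all s d refl = All.lookup all (∈-++⁺ʳ s (here refl))

-- Counting smaller letters

countBelow-mono : ∀ ys {u v} → u ≤ v → countBelow u ys ≤ countBelow v ys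
countBelow-mono []       u≤v = z≤n
countBelow-mono (z ∷ ys) u≤v = +-mono-≤ (indicator-<ᵇ-mono z u≤v) (countBelow-mono ys u≤v)

countBelow-strict : ∀ {ys u v} → u ∈ ys → u < v → countBelow u ys < countBelow v ys
countBelow-strict {u ∷ ys} {u} {v} (here refl) u<v rewrite n<ᵇn≡false u | <ᵇ-true u<v =
  s≤s (countBelow-mono ys (<⇒≤ u<v))
countBelow-strict {z ∷ ys} (there u∈ys) u<v =
  +-mono-≤-< (indicator-<ᵇ-mono z (<⇒≤ u<v)) (countBelow-strict u∈ys u<v)

countBelow≤length : ∀ u ys → countBelow u ys ≤ length ys
countBelow≤length u []       = z≤n
countBelow≤length u (z ∷ ys) with z <ᵇ u
... | true  = s≤s (countBelow≤length u ys)
... | false = m≤n⇒m≤1+n (countBelow≤length u ys)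

countBelow<length : ∀ {u ys} → u ∈ ys → countBelow u ys < length ys
countBelow<length {u} {u ∷ ys} (here refl) rewrite n<ᵇn≡false u = s≤s (countBelow≤length u ys)
countBelow<length {u} {z ∷ ys} (there u∈ys) with z <ᵇ u
... | true  = s≤s (countBelow<length u∈ys)
... | false = m≤n⇒m≤1+n (countBelow<length u∈ys)

countBelow-minimum : ∀ {u ys} → All (u ≤_) ys → countBelow u ys ≡ 0
countBelow-minimum []                     = refl
countBelow-minimum {u} {z ∷ _} (u≤z ∷ ps) rewrite <ᵇ-false {z} {u} (≤⇒≯ u≤z) = countBelow-minimum ps

countBelow-maximum : ∀ {u ys} → All (_< u) ys → countBelow u ys ≡ length ys
countBelow-maximum []             = refl
countBelow-maximum (z<u ∷ ps) rewrite <ᵇ-true z<u = cong suc (countBelow-maximum ps)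

countBelow-++ : ∀ u xs ys → countBelow u (xs ++ ys) ≡ countBelow u xs + countBelow u ys
countBelow-++ u []       ys = refl
countBelow-++ u (z ∷ xs) ys rewrite countBelow-++ u xs ys = sym (+-assoc (indicator (z <ᵇ u)) _ _)

countBelow-↭ : ∀ u {xs ys} → xs ↭ ys → countBelow u xs ≡ countBelow u ys
countBelow-↭ u {xs} {ys} p = begin
  countBelow u xs ≡⟨ countBelow≡sum xs ⟩
  sum (map below xs) ≡⟨ sum-↭ (↭.map⁺ below p) ⟩
  sum (map below ys) ≡⟨ countBelow≡sum ys ⟨
  countBelow u ys ∎
  where
  open ≡-Reasoning
  below : ℕ → ℕ
  below z = indicator (z <ᵇ u)
  countBelow≡sum : ∀ zs → countBelow u zs ≡ sum (map below zs)
  countBelow≡sum []       = refl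
  countBelow≡sum (z ∷ zs) = cong (below z +_) (countBelow≡sum zs)

-- Strictly monotone relabellings

StrictlyMonotoneOn : List ℕ → (ℕ → ℕ) → Set
StrictlyMonotoneOn xs f = ∀ {u v} → u ∈ xs → v ∈ xs → u < v → f u < f v

module _ {xs : List ℕ} {f : ℕ → ℕ} (mono : StrictlyMonotoneOn xs f) where

  StrictlyMonotoneOn-⊆ : ∀ {ys} → ys ⊆ xs → StrictlyMonotoneOn ys f
  StrictlyMonotoneOn-⊆ ys⊆xs u∈ v∈ = mono (ys⊆xs u∈) (ys⊆xs v∈)

  StrictlyMonotoneOn-< : ∀ {u v} → u ∈ xs → v ∈ xs → u < v ⇔ f u < f v
  StrictlyMonotoneOn-< {u} {v} u∈ v∈ = mk⇔ (mono u∈ v∈) reflect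
    where
    reflect : f u < f v → u < v
    reflect fu<fv with <-cmp u v
    ... | tri< u<v _ _ = u<v
    ... | tri≈ _ refl _ = contradiction fu<fv (<-irrefl refl)
    ... | tri> _ _ v<u = contradiction (mono v∈ u∈ v<u) (<⇒≯ fu<fv)

  StrictlyMonotoneOn-≡ : ∀ {u v} → u ∈ xs → v ∈ xs → u ≡ v ⇔ f u ≡ f v
  StrictlyMonotoneOn-≡ {u} {v} u∈ v∈ = mk⇔ (cong f) reflect
    where
    reflect : f u ≡ f v → u ≡ v
    reflect fu≡fv with <-cmp u v
    ... | tri< u<v _ _ = contradiction fu≡fv (<⇒≢ (mono u∈ v∈ u<v))
    ... | tri≈ _ u≡v _ = u≡v
    ... | tri> _ _ v<u = contradiction (sym fu≡fv) (<⇒≢ (mono v∈ u∈ v<u))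

  StrictlyMonotoneOn-≤ : ∀ {u v} → u ∈ xs → v ∈ xs → u ≤ v → f u ≤ f v
  StrictlyMonotoneOn-≤ {u} {v} u∈ v∈ u≤v with m≤n⇒m<n∨m≡n u≤v
  ... | inj₁ u<v  = <⇒≤ (mono u∈ v∈ u<v)
  ... | inj₂ refl = ≤-refl

  countBelow-map : ∀ {u ws} → u ∈ xs → ws ⊆ xs → countBelow (f u) (map f ws) ≡ countBelow u ws
  countBelow-map {ws = []}     u∈ ws⊆xs = refl
  countBelow-map {ws = w ∷ ws} u∈ ws⊆xs =
    cong₂ _+_ (cong indicator (<ᵇ-cong (⇔-sym (StrictlyMonotoneOn-< (ws⊆xs (here refl)) u∈))))
              (countBelow-map u∈ (ws⊆xs ∘ there))

  st-map : st (map f xs) ≡ st xs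
  st-map = begin
    map (λ x → suc (countBelow x (map f xs))) (map f xs) ≡⟨ map-∘ xs ⟨
    map (λ u → suc (countBelow (f u) (map f xs))) xs     ≡⟨ map-cong-local (All.tabulate λ u∈ → cong suc (countBelow-map u∈ id)) ⟩
    map (λ u → suc (countBelow u xs)) xs                 ∎
    where open ≡-Reasoning

  Unique-map : Unique xs → Unique (map f xs)
  Unique-map = go id
    where
    go : ∀ {ys} → ys ⊆ xs → Unique ys → Unique (map f ys)
    go {[]}     _      []           = []
    go {y ∷ ys} ys⊆xs (y∉ys ∷ uniq) =
      All.map⁺ (All.tabulate λ v∈ fy≡fv →
        All.lookup y∉ys v∈ (from (StrictlyMonotoneOn-≡ (ys⊆xs (here refl)) (ys⊆xs (there v∈))) fy≡fv))
      ∷ go (ys⊆xs ∘ there) uniq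

  AllPairs-map⇔ : ∀ {R S : ℕ → ℕ → Set} → (∀ {u v} → u ∈ xs → v ∈ xs → R u v ⇔ S (f u) (f v)) →
                  AllPairs S (map f xs) ⇔ AllPairs R xs
  AllPairs-map⇔ {R} {S} R⇔S = mk⇔ (go⁻ id) (go⁺ id)
    where
    go⁻ : ∀ {ys} → ys ⊆ xs → AllPairs S (map f ys) → AllPairs R ys
    go⁻ {[]}     _     []         = []
    go⁻ {y ∷ ys} ys⊆xs (Sy ∷ Sys) =
      All.tabulate (λ v∈ → from (R⇔S (ys⊆xs (here refl)) (ys⊆xs (there v∈))) (All.lookup (All.map⁻ Sy) v∈))
      ∷ go⁻ (ys⊆xs ∘ there) Sys
    go⁺ : ∀ {ys} → ys ⊆ xs → AllPairs R ys → AllPairs S (map f ys)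
    go⁺ {[]}     _     []         = []
    go⁺ {y ∷ ys} ys⊆xs (Ry ∷ Rys) =
      All.map⁺ (All.tabulate (λ v∈ → to (R⇔S (ys⊆xs (here refl)) (ys⊆xs (there v∈))) (All.lookup Ry v∈)))
      ∷ go⁺ (ys⊆xs ∘ there) Rys

des-map : ∀ {xs f} → StrictlyMonotoneOn xs f → des (map f xs) ≡ des xs
des-map {[]}          mono = refl
des-map {x ∷ []}      mono = refl
des-map {x ∷ y ∷ xs}  mono =
  cong₂ _+_ (cong indicator (<ᵇ-cong (⇔-sym (StrictlyMonotoneOn-< mono (there (here refl)) (here refl)))))
            (des-map (StrictlyMonotoneOn-⊆ mono there))

LastBelow-map : ∀ {c u f} → StrictlyMonotoneOn (u ∷ʳ c) f → LastBelow c u → LastBelow (f c) (map f u)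
LastBelow-map {c} {u} {f} mono lb with initLast u
... | []      = λ { [] _ () ; (_ ∷ _) _ () }
... | s ∷ʳ′ d = subst (LastBelow (f c)) (sym (map-++ f s [ d ]))
  (LastBelow-∷ʳ (mono (∈-++⁺ˡ (∈-++⁺ʳ s (here refl))) (∈-++⁺ʳ (s ∷ʳ d) (here refl)) (lb s d refl)))

rank : List ℕ → ℕ → ℕ
rank ys u = suc (countBelow u ys)

rank-strictlyMonotone : ∀ ys → StrictlyMonotoneOn ys (rank ys)
rank-strictlyMonotone ys u∈ys _ u<v = s≤s (countBelow-strict u∈ys u<v)

st-idempotent : ∀ ys → st (st ys) ≡ st ys
st-idempotent ys = st-map (rank-strictlyMonotone ys)

-- Blocks

maxList-upper : ∀ {u xs} → u ∈ xs → u ≤ maxList xs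
maxList-upper {xs = x ∷ xs} (here refl) = m≤m⊔n x (maxList xs)
maxList-upper {xs = x ∷ xs} (there u∈) = ≤-trans (maxList-upper u∈) (m≤n⊔m x (maxList xs))

maxList-least : ∀ {v xs} → All (_≤ v) xs → maxList xs ≤ v
maxList-least []           = z≤n
maxList-least (x≤v ∷ xs≤v) = ⊔-lub x≤v (maxList-least xs≤v)

maxList-∈ : ∀ x xs → maxList (x ∷ xs) ∈ x ∷ xs
maxList-∈ x []       = here (⊔-identityʳ x)
maxList-∈ x (y ∷ ys) with ⊔-sel x (maxList (y ∷ ys))
... | inj₁ eq = here eq
... | inj₂ eq = there (subst (_∈ y ∷ ys) (sym eq) (maxList-∈ y ys))

maxList-head : ∀ {x xs} → All (_≤ x) xs → maxList (x ∷ xs) ≡ x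
maxList-head {x} {xs} xs≤x = ≤-antisym (maxList-least (≤-refl ∷ xs≤x)) (maxList-upper {xs = x ∷ xs} (here refl))

maxList-map : ∀ {x xs f} → StrictlyMonotoneOn (x ∷ xs) f → maxList (map f (x ∷ xs)) ≡ f (maxList (x ∷ xs))
maxList-map {x} {xs} {f} mono = ≤-antisym
  (maxList-least (All.map⁺ (All.tabulate λ u∈ → StrictlyMonotoneOn-≤ mono u∈ max∈ (maxList-upper u∈))))
  (maxList-upper (∈-map⁺ f max∈))
  where
  max∈ = maxList-∈ x xs

prefixTo-map : ∀ {m xs f} → (∀ {z} → z ∈ xs → (f m ≡ᵇ f z) ≡ (m ≡ᵇ z)) →
               prefixTo (f m) (map f xs) ≡ Product.map (map f) (map f) (prefixTo m xs)
prefixTo-map {xs = []}     _ = refl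
prefixTo-map {m} {x ∷ xs} {f} same rewrite same (here refl) with m ≡ᵇ x
... | true  = refl
... | false = cong (Product.map₁ (f x ∷_)) (prefixTo-map (same ∘ there))

blocksF-infix : ∀ j xs {b} → b ∈ blocksF j xs → ∃₂ λ A B → xs ≡ A ++ b ++ B
blocksF-infix (suc j) (x ∷ xs) (here refl) = [] , _ , sym (prefixTo-++ (maxList (x ∷ xs)) (x ∷ xs))
blocksF-infix (suc j) (x ∷ xs) (there b∈) with blocksF-infix j _ b∈
... | A , B , eq = proj₁ P ++ A , B , (begin
  x ∷ xs                     ≡⟨ prefixTo-++ (maxList (x ∷ xs)) (x ∷ xs) ⟨
  proj₁ P ++ proj₂ P         ≡⟨ cong (proj₁ P ++_) eq ⟩
  proj₁ P ++ A ++ _ ++ B     ≡⟨ ++-assoc (proj₁ P) A _ ⟨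
  (proj₁ P ++ A) ++ _ ++ B   ∎)
  where
  open ≡-Reasoning
  P = prefixTo (maxList (x ∷ xs)) (x ∷ xs)

blocksF-⊆ : ∀ j xs {b} → b ∈ blocksF j xs → b ⊆ xs
blocksF-⊆ j xs b∈ with blocksF-infix j xs b∈
... | A , B , refl = ∈-++⁺ʳ A ∘ ∈-++⁺ˡ

Unique-blocks : ∀ {L bl} → Unique L → bl ∈ blocks L → Unique bl
Unique-blocks {L} {bl} uniq bl∈ with blocksF-infix (length L) L bl∈
... | A , B , refl = AllPairs-++⁻ˡ bl (AllPairs-++⁻ʳ A uniq)

length-blocks : ∀ {L bl} → bl ∈ blocks L → length bl ≤ length L
length-blocks {L} {bl} bl∈ with blocksF-infix (length L) L bl∈
... | A , B , refl rewrite length-++ A {bl ++ B} | length-++ bl {B} = ≤-trans (m≤m+n _ _) (m≤n+m _ (length A))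

blocksF-map : ∀ j {xs f} → StrictlyMonotoneOn xs f → blocksF j (map f xs) ≡ map (map f) (blocksF j xs)
blocksF-map zero               _    = refl
blocksF-map (suc j) {[]}       _    = refl
blocksF-map (suc j) {x ∷ xs} {f} mono = begin
  proj₁ P′ ∷ blocksF j (proj₂ P′)              ≡⟨ cong (λ p → proj₁ p ∷ blocksF j (proj₂ p)) P′≡ ⟩
  map f (proj₁ P) ∷ blocksF j (map f (proj₂ P)) ≡⟨ cong (map f (proj₁ P) ∷_) (blocksF-map j (StrictlyMonotoneOn-⊆ mono rest⊆)) ⟩
  map f (proj₁ P) ∷ map (map f) (blocksF j (proj₂ P)) ∎
  where
  open ≡-Reasoning
  m = maxList (x ∷ xs)
  P = prefixTo m (x ∷ xs)
  P′ = prefixTo (maxList (map f (x ∷ xs))) (map f (x ∷ xs))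
  P′≡ : P′ ≡ Product.map (map f) (map f) P
  P′≡ rewrite maxList-map mono =
    prefixTo-map (λ z∈ → ≡ᵇ-cong (⇔-sym (StrictlyMonotoneOn-≡ mono (maxList-∈ x xs) z∈)))
  rest⊆ : proj₂ P ⊆ x ∷ xs
  rest⊆ = subst (proj₂ P ⊆_) (prefixTo-++ m (x ∷ xs)) (∈-++⁺ʳ (proj₁ P))

cost : ℕ → List ℕ → ℕ
cost k u = wF k (st u) + des u

blockSum : ℕ → List ℕ → ℕ
blockSum k L = sum (map (cost k) (blocks L))

cost-map : ∀ k {xs f} → StrictlyMonotoneOn xs f → cost k (map f xs) ≡ cost k xs
cost-map k mono = cong₂ _+_ (cong (wF k) (st-map mono)) (des-map mono)

blockSum-map : ∀ k {xs f} → StrictlyMonotoneOn xs f → blockSum k (map f xs) ≡ blockSum k xs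
blockSum-map k {xs} {f} mono = begin
  sum (map (cost k) (blocksF (length (map f xs)) (map f xs))) ≡⟨ cong (λ j → sum (map (cost k) (blocksF j (map f xs)))) (length-map f xs) ⟩
  sum (map (cost k) (blocksF (length xs) (map f xs)))         ≡⟨ cong (sum ∘ map (cost k)) (blocksF-map (length xs) mono) ⟩
  sum (map (cost k) (map (map f) (blocks xs)))                ≡⟨ cong sum (map-∘ (blocks xs)) ⟨
  sum (map (cost k ∘ map f) (blocks xs))                      ≡⟨ cong sum (map-cong-local (All.tabulate λ b∈ →
                                                                   cost-map k (StrictlyMonotoneOn-⊆ mono (blocksF-⊆ (length xs) xs b∈)))) ⟩
  sum (map (cost k) (blocks xs))                              ∎
  where open ≡-Reasoning

des-∷ʳ-∷ʳ : ∀ s d c → des ((s ∷ʳ d) ∷ʳ c) ≡ des (s ∷ʳ d) + indicator (c <ᵇ d)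
des-∷ʳ-∷ʳ []          d c = +-comm (indicator (c <ᵇ d)) 0
des-∷ʳ-∷ʳ (x ∷ [])    d c =
  trans (cong (indicator (d <ᵇ x) +_) (des-∷ʳ-∷ʳ [] d c)) (sym (+-assoc (indicator (d <ᵇ x)) 0 _))
des-∷ʳ-∷ʳ (x ∷ y ∷ s) d c =
  trans (cong (indicator (y <ᵇ x) +_) (des-∷ʳ-∷ʳ (y ∷ s) d c)) (sym (+-assoc (indicator (y <ᵇ x)) _ _))

des-∷ʳ : ∀ {u c} → LastBelow c u → des (u ∷ʳ c) ≡ des u
des-∷ʳ {u} {c} lb with initLast u
... | []      = refl
... | s ∷ʳ′ d rewrite des-∷ʳ-∷ʳ s d c | <ᵇ-false {c} {d} (<⇒≯ (lb s d refl)) = +-identityʳ _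

wF-idWord : ∀ k n → wF k (idWord n) ≡ 0
wF-idWord zero    n = refl
wF-idWord (suc k) n rewrite length-map suc (upTo n) | length-upTo n
  | Equivalence.to T-≡ (eqList-refl (idWord n)) = refl

cost-singleton : ∀ k x → cost k [ x ] ≡ 0
cost-singleton k x rewrite n<ᵇn≡false x = trans (+-identityʳ _) (wF-idWord k 1)

blockSum-decreasing : ∀ k {L} → AllPairs _>_ L → blockSum k L ≡ 0
blockSum-decreasing k {L} = go (length L)
  where
  go : ∀ j {xs} → AllPairs _>_ xs → sum (map (cost k) (blocksF j xs)) ≡ 0
  go zero    _ = refl
  go (suc j) {[]} _ = refl
  go (suc j) {x ∷ xs} (x>xs ∷ dec)
    rewrite maxList-head (All.map <⇒≤ x>xs) | ≡ᵇ-true {x} refl | cost-singleton k x = go j dec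

-- the one-line notation of a permutation of 1, …, length y
Standard : List ℕ → Set
Standard y = Unique y × st y ≡ y

Standard-st : ∀ {y} → Unique y → Standard (st y)
Standard-st {y} uniq = Unique-map (rank-strictlyMonotone y) uniq , st-idempotent y

Standard-st-init : ∀ {x c} → Standard (x ∷ʳ c) → Standard (st x)
Standard-st-init {x} std = Standard-st (AllPairs-++⁻ˡ x (proj₁ std))

module _ {y} (std : Standard y) where

  Standard-rank : ∀ {u} → u ∈ y → rank y u ≡ u
  Standard-rank = map-fixed (proj₂ std)

  Standard-≤length : ∀ {u} → u ∈ y → u ≤ length y
  Standard-≤length u∈ = subst (_≤ length y) (Standard-rank u∈) (countBelow<length u∈)

  Standard-positive : ∀ {u} → u ∈ y → 0 < u
  Standard-positive u∈ = subst (0 <_) (Standard-rank u∈) z<s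

  Standard-minimum : ∀ {u} → u ∈ y → All (u ≤_) y → u ≡ 1
  Standard-minimum u∈ u≤y = trans (sym (Standard-rank u∈)) (cong suc (countBelow-minimum u≤y))

  Standard-∌suc-length : suc (length y) ∉ y
  Standard-∌suc-length N∈ = <-irrefl refl (Standard-≤length N∈)

Standard-∋1 : ∀ {y u} → Standard y → u ∈ y → 1 ∈ y
Standard-∋1 {x ∷ xs} std _ = subst (_∈ x ∷ xs) (Standard-minimum std m∈ (min≤⊤ x xs ∷ min≤xs x xs)) m∈
  where
  m∈ : min x xs ∈ x ∷ xs
  m∈ = argmin-all id (here refl) (All.tabulate there)

idWord-suc : ∀ n → idWord (suc n) ≡ 1 ∷ map suc (idWord n)
idWord-suc n = cong (λ l → 1 ∷ map suc l) (sym (map-upTo suc n))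

st-increasing : ∀ {xs} → AllPairs _<_ xs → st xs ≡ idWord (length xs)
st-increasing {[]}     []           = refl
st-increasing {x ∷ xs} (x<xs ∷ inc) = begin
  rank (x ∷ xs) x ∷ map (rank (x ∷ xs)) xs ≡⟨ cong₂ _∷_ rank-head (map-cong-local (All.map rank-tail x<xs)) ⟩
  1 ∷ map (suc ∘ rank xs) xs              ≡⟨ cong (1 ∷_) (map-∘ xs) ⟩
  1 ∷ map suc (st xs)                     ≡⟨ cong (λ l → 1 ∷ map suc l) (st-increasing inc) ⟩
  1 ∷ map suc (idWord (length xs))        ≡⟨ idWord-suc (length xs) ⟨
  idWord (suc (length xs))                ∎
  where
  open ≡-Reasoning
  rank-head : rank (x ∷ xs) x ≡ 1
  rank-head rewrite n<ᵇn≡false x = cong suc (countBelow-minimum (All.map <⇒≤ x<xs))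
  rank-tail : ∀ {u} → x < u → rank (x ∷ xs) u ≡ suc (rank xs u)
  rank-tail x<u rewrite <ᵇ-true x<u = refl

idWord-increasing : ∀ n → AllPairs _<_ (idWord n)
idWord-increasing n = AllPairs.map⁺ (AllPairs.applyUpTo⁺₁ id n λ i<j _ → s≤s i<j)

reverse-idWord-decreasing : ∀ n → AllPairs _>_ (reverse (idWord n))
reverse-idWord-decreasing n
  rewrite sym (reverse-map suc (upTo n)) | reverse-upTo n =
  AllPairs.map⁺ (AllPairs.applyDownFrom⁺₁ id n λ j<i _ → s≤s j<i)

Standard-idWord : ∀ n → Standard (idWord n)
Standard-idWord n =
  Unique.map⁺ suc-injective (Unique.upTo⁺ n) ,
  trans (st-increasing (idWord-increasing n)) (cong idWord (trans (length-map suc (upTo n)) (length-upTo n)))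

↭-idWord⇒Standard : ∀ {xs n} → xs ↭ idWord n → Standard xs
↭-idWord⇒Standard {xs} {n} p =
  Unique-resp-↭ (↭⇒↭ₛ (↭-sym p)) (proj₁ (Standard-idWord n)) ,
  map-id-local (All.tabulate λ {u} u∈ →
    trans (cong suc (countBelow-↭ u p)) (Standard-rank (Standard-idWord n) (↭.∈-resp-↭ p u∈)))

increasing-∷ʳ⇔ : ∀ {x c} → LastBelow c x → AllPairs _<_ (x ∷ʳ c) ⇔ AllPairs _<_ x
increasing-∷ʳ⇔ {x} {c} lb = mk⇔ (AllPairs-++⁻ˡ x) λ inc → AllPairs.++⁺ inc ([] ∷ []) (All.map (_∷ []) (below-c inc))
  where
  below-c : AllPairs _<_ x → All (_< c) x
  below-c inc with initLast x
  ... | []      = []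
  ... | s ∷ʳ′ d = All.++⁺ (All.map (λ z<d → <-trans z<d (lb s d refl)) (AllPairs-∷ʳ⁻ s inc)) (lb s d refl ∷ [])

Standard-right-unique : ∀ {y} L R → Standard y → y ≡ L ++ 1 ∷ R → Unique (R ∷ʳ suc (length y))
Standard-right-unique L R std refl = AllPairs.tail (AllPairs-++⁻ʳ L
  (subst Unique (++-assoc L (1 ∷ R) _) (Unique-∷ʳ (proj₁ std) (Standard-∌suc-length std))))

-- The recursion defining w

isIdentity : List ℕ → Bool
isIdentity π = eqList π (idWord (length π))

isReversal : List ℕ → Bool
isReversal π = eqList π (reverse (idWord (length π)))

isIdentity-reflects : ∀ {y} → Standard y → Reflects (AllPairs _<_ y) (isIdentity y)
isIdentity-reflects {y} std = fromEquivalence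
  (λ t → subst (AllPairs _<_) (sym (eqList-sound _ _ t)) (idWord-increasing (length y)))
  (λ inc → subst (T ∘ eqList y) (trans (sym (proj₂ std)) (st-increasing inc)) (eqList-refl y))

isReversal⇒decreasing : ∀ {y} → T (isReversal y) → AllPairs _>_ y
isReversal⇒decreasing {y} t = subst (AllPairs _>_) (sym (eqList-sound _ _ t)) (reverse-idWord-decreasing (length y))

splitWeight : ℕ → List ℕ × List ℕ → ℕ
splitWeight k (L , R) = cost k R + blockSum k L

-- wF (suc k) π  reduces to  if isIdentity π ∨ isReversal π then 0 else recurse k π.
recurse : ℕ → List ℕ → ℕ
recurse k π = splitWeight k (splitAt1st 1 (π ∷ʳ suc (length π)))

recurse-split : ∀ k {π} L R → 1 ∉ L → π ≡ L ++ 1 ∷ R → recurse k π ≡ cost k (R ∷ʳ suc (length π)) + blockSum k L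
recurse-split k L R 1∉L refl =
  cong (splitWeight k) (trans (cong (splitAt1st 1) (++-assoc L (1 ∷ R) _)) (splitAt1st-∉ L 1∉L))

recurse-decreasing : ∀ k {y} → Standard y → AllPairs _>_ y → 1 ∈ y → recurse k y ≡ 0
recurse-decreasing k {y} std dec 1∈y with Unique-split (proj₁ std) 1∈y
... | L , [] , refl , 1∉L =
  trans (recurse-split k L [] 1∉L refl) (cong₂ _+_ (cost-singleton k (suc (length (L ++ 1 ∷ [])))) (blockSum-decreasing k (AllPairs-++⁻ˡ L dec)))
... | L , r ∷ R , refl , _ with AllPairs-++⁻ʳ L dec
...   | (r<1 ∷ _) ∷ _ = contradiction (Standard-positive std (∈-++⁺ʳ L (there (here refl)))) (<⇒≱ r<1)

-- Removing a final ascent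

DropLastAscent : ℕ → Set
DropLastAscent k = ∀ {u c} → Standard (u ∷ʳ c) → LastBelow c u → wF k (st u) ≡ wF k (u ∷ʳ c)

cost-∷ʳ : ∀ k {u c} → DropLastAscent k → Unique (u ∷ʳ c) → LastBelow c u → cost k (u ∷ʳ c) ≡ cost k u
cost-∷ʳ k {u} {c} drop uniq lb = cong₂ _+_ wF-eq (des-∷ʳ lb)
  where
  open ≡-Reasoning
  r = rank (u ∷ʳ c)
  mono = rank-strictlyMonotone (u ∷ʳ c)
  wF-eq : wF k (st (u ∷ʳ c)) ≡ wF k (st u)
  wF-eq = begin
    wF k (map r (u ∷ʳ c)) ≡⟨ cong (wF k) (map-++ r u [ c ]) ⟩
    wF k (map r u ∷ʳ r c) ≡⟨ drop (subst Standard (map-++ r u [ c ]) (Standard-st uniq)) (LastBelow-map mono lb) ⟨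
    wF k (st (map r u))   ≡⟨ cong (wF k) (st-map (StrictlyMonotoneOn-⊆ mono ∈-++⁺ˡ)) ⟩
    wF k (st u)           ∎

isIdentity-dropLastAscent : ∀ {x c} → Standard (x ∷ʳ c) → LastBelow c x → isIdentity (st x) ≡ isIdentity (x ∷ʳ c)
isIdentity-dropLastAscent {x} std lb =
  Reflects-cong (isIdentity-reflects (Standard-st-init std)) (isIdentity-reflects std)
    (⇔-sym (increasing-∷ʳ⇔ lb) ⇔-∘ AllPairs-map⇔ mono (StrictlyMonotoneOn-< mono))
  where
  mono = rank-strictlyMonotone x

isReversal-ascent : ∀ σ {a c} → a < c → isReversal ((σ ∷ʳ a) ∷ʳ c) ≡ false
isReversal-ascent σ {a} {c} a<c with isReversal ((σ ∷ʳ a) ∷ʳ c) in eq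
... | false = refl
... | true with AllPairs-++⁻ʳ σ (subst (AllPairs _>_) (++-assoc σ [ a ] [ c ]) (isReversal⇒decreasing (subst T (sym eq) tt)))
...   | (c<a ∷ []) ∷ _ = contradiction a<c (<⇒≯ c<a)

st-split-at-1 : ∀ L R → All (0 <_) (L ++ 1 ∷ R) → 1 ∉ L →
                st (L ++ 1 ∷ R) ≡ map (rank (L ++ 1 ∷ R)) L ++ 1 ∷ map (rank (L ++ 1 ∷ R)) R
                × 1 ∉ map (rank (L ++ 1 ∷ R)) L
st-split-at-1 L R pos 1∉L = st-x , 1∉rL
  where
  x = L ++ 1 ∷ R
  r = rank x
  r1≡1 : r 1 ≡ 1
  r1≡1 = cong suc (countBelow-minimum pos)
  st-x : st x ≡ map r L ++ 1 ∷ map r R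
  st-x = trans (map-++ r L (1 ∷ R)) (cong (λ v → map r L ++ v ∷ map r R) r1≡1)
  1∉rL : 1 ∉ map r L
  1∉rL 1∈rL with ∈-map⁻ r 1∈rL
  ... | u , u∈L , 1≡ru = 1∉L (subst (_∈ L)
    (from (StrictlyMonotoneOn-≡ (rank-strictlyMonotone x) (∈-++⁺ˡ u∈L) (∈-++⁺ʳ L (here refl))) (trans (sym 1≡ru) (sym r1≡1)))
    u∈L)

recurse-dropLastAscent : ∀ k {x c} → DropLastAscent k → Standard (x ∷ʳ c) → LastBelow c x → 1 ∈ x →
                         recurse k (st x) ≡ recurse k (x ∷ʳ c)
recurse-dropLastAscent k {x} {c} drop std lb 1∈x with Unique-split (AllPairs-++⁻ˡ x (proj₁ std)) 1∈x
... | L , R , refl , 1∉L = begin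
  recurse k (st x)                                ≡⟨ recurse-split k (map r L) (map r R) 1∉rL st-x ⟩
  cost k (map r R ∷ʳ N′) + blockSum k (map r L)   ≡⟨ cong₂ _+_ cost-R (blockSum-map k {L} (mono-on ∈-++⁺ˡ)) ⟩
  cost k ((R ∷ʳ c) ∷ʳ N) + blockSum k L           ≡⟨ recurse-split k L (R ∷ʳ c) 1∉L (++-assoc L (1 ∷ R) [ c ]) ⟨
  recurse k (x ∷ʳ c)                              ∎
  where
  open ≡-Reasoning
  r = rank x
  N = suc (length (x ∷ʳ c))
  N′ = suc (length (st x))
  mono-on : ∀ {ys} → ys ⊆ x → StrictlyMonotoneOn ys r
  mono-on = StrictlyMonotoneOn-⊆ (rank-strictlyMonotone x)
  split = st-split-at-1 L R (All.tabulate λ u∈x → Standard-positive std (∈-++⁺ˡ {ys = [ c ]} u∈x)) 1∉L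
  st-x = proj₁ split
  1∉rL = proj₂ split
  uniq-R′ : Unique (map r R ∷ʳ N′)
  uniq-R′ = Standard-right-unique (map r L) (map r R) (Standard-st-init std) st-x
  uniq-RcN : Unique ((R ∷ʳ c) ∷ʳ N)
  uniq-RcN = Standard-right-unique L (R ∷ʳ c) std (++-assoc L (1 ∷ R) [ c ])
  below-N′ : All (_< N′) (map r R)
  below-N′ = All.map⁺ (All.tabulate λ {u} u∈R →
    s≤s (subst (countBelow u x <_) (sym (length-map r x)) (countBelow<length (∈-++⁺ʳ L (there u∈R)))))
  lb-R : LastBelow c R
  lb-R = LastBelow-++⁻ʳ (L ∷ʳ 1) (subst (LastBelow c) (sym (++-assoc L [ 1 ] R)) lb)
  cost-R : cost k (map r R ∷ʳ N′) ≡ cost k ((R ∷ʳ c) ∷ʳ N)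
  cost-R = begin
    cost k (map r R ∷ʳ N′)  ≡⟨ cost-∷ʳ k drop uniq-R′ (All⇒LastBelow below-N′) ⟩
    cost k (map r R)        ≡⟨ cost-map k (mono-on (∈-++⁺ʳ L ∘ there)) ⟩
    cost k R                ≡⟨ cost-∷ʳ k drop (AllPairs-++⁻ˡ (R ∷ʳ c) uniq-RcN) lb-R ⟨
    cost k (R ∷ʳ c)         ≡⟨ cost-∷ʳ k drop uniq-RcN (LastBelow-∷ʳ (s≤s (Standard-≤length std (∈-++⁺ʳ x (here refl))))) ⟨
    cost k ((R ∷ʳ c) ∷ʳ N)  ∎

dropLastAscent : ∀ k → DropLastAscent k
dropLastAscent zero    _   _  = refl
dropLastAscent (suc k) {u} {c} std lb with initLast u
... | [] rewrite Standard-minimum std (here refl) (≤-refl ∷ []) = refl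
... | σ ∷ʳ′ a =
  if-∨-cong (isIdentity-dropLastAscent std lb) (isReversal-ascent σ a<c)
    (λ rev → recurse-decreasing k (Standard-st-init std) (isReversal⇒decreasing rev)
               (Standard-∋1 (Standard-st-init std) (∈-map⁺ (rank x) 1∈x)))
    (recurse-dropLastAscent k (dropLastAscent k) std lb 1∈x)
  where
  x = σ ∷ʳ a
  a<c = lb σ a refl
  1∈x : 1 ∈ x
  1∈x with ∈-++⁻ x (Standard-∋1 std (∈-++⁺ʳ x (here refl)))
  ... | inj₁ 1∈x        = 1∈x
  ... | inj₂ (here refl) = contradiction (Standard-positive std (∈-++⁺ˡ (∈-++⁺ʳ σ (here refl)))) (<⇒≱ a<c)

-- Sufficient fuel

idPrefixLength : ℕ → List ℕ → ℕ
idPrefixLength c []       = 0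
idPrefixLength c (v ∷ xs) = if c ≡ᵇ v then suc (idPrefixLength (suc c) xs) else 0

-- Every recursive call of wF on a permutation y is on a word of smaller measure: a shorter one,
-- or, when y starts with 1, one of the same length whose prefix 1 2 ⋯ j is one letter shorter.
measure : List ℕ → ℕ
measure y = length y * length y + idPrefixLength 1 y

idPrefixLength≤length : ∀ c xs → idPrefixLength c xs ≤ length xs
idPrefixLength≤length c []       = z≤n
idPrefixLength≤length c (v ∷ xs) with c ≡ᵇ v
... | true  = s≤s (idPrefixLength≤length (suc c) xs)
... | false = z≤n

idPrefixLength-pred : ∀ c {xs} → All (0 <_) xs → idPrefixLength c (map pred xs) ≡ idPrefixLength (suc c) xs
idPrefixLength-pred c []                       = refl
idPrefixLength-pred c {suc v ∷ xs} (_ ∷ pos) with c ≡ᵇ v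
... | true  = cong suc (idPrefixLength-pred (suc c) pos)
... | false = refl

idPrefixLength-++ : ∀ c xs ys → idPrefixLength c xs < length xs → idPrefixLength c (xs ++ ys) ≡ idPrefixLength c xs
idPrefixLength-++ c (v ∷ xs) ys lt with c ≡ᵇ v
... | true  = cong suc (idPrefixLength-++ (suc c) xs ys (≤-pred lt))
... | false = refl

idPrefixLength-full : ∀ c xs → idPrefixLength (suc c) xs ≡ length xs → xs ≡ map (c +_) (idWord (length xs))
idPrefixLength-full c []       _  = refl
idPrefixLength-full c (v ∷ xs) eq with suc c ≡ᵇ v | ≡ᵇ-reflects-≡ (suc c) v
... | true | ofʸ refl = begin
  suc c ∷ xs                             ≡⟨ cong₂ _∷_ (+-comm 1 c) (idPrefixLength-full (suc c) xs (suc-injective eq)) ⟩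
  c + 1 ∷ map (suc c +_) (idWord m)      ≡⟨ cong (c + 1 ∷_) (map-cong (+-suc c) (idWord m)) ⟨
  c + 1 ∷ map ((c +_) ∘ suc) (idWord m)  ≡⟨ cong (c + 1 ∷_) (map-∘ (idWord m)) ⟩
  map (c +_) (1 ∷ map suc (idWord m))    ≡⟨ cong (map (c +_)) (idWord-suc m) ⟨
  map (c +_) (idWord (suc m))            ∎
  where
  open ≡-Reasoning
  m = length xs

square-bound : ∀ {m n} → m < n → m * m + m < n * n
square-bound {m} {suc n} (s≤s m≤n) = begin-strict
  m * m + m          ≤⟨ +-mono-≤ (*-mono-≤ m≤n m≤n) m≤n ⟩
  n * n + n          <⟨ n<1+n _ ⟩
  suc (n * n + n)    ≡⟨ cong suc (+-comm (n * n) n) ⟩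
  suc (n + n * n)    ≤⟨ s≤s (+-monoʳ-≤ n (*-monoʳ-≤ n (n≤1+n n))) ⟩
  suc n * suc n      ∎
  where open ≤-Reasoning

measure≤ : ∀ y → measure y ≤ length y * length y + length y
measure≤ y = +-monoʳ-≤ (length y * length y) (idPrefixLength≤length 1 y)

measure-shorter : ∀ {y n} → length y < n → measure y < n * n
measure-shorter {y} lt = ≤-<-trans (measure≤ y) (square-bound lt)

st-standard-tail : ∀ {R} → Standard (1 ∷ R) → st (R ∷ʳ suc (length (1 ∷ R))) ≡ map pred (R ∷ʳ suc (length (1 ∷ R)))
st-standard-tail {R} std = map-cong-local (All.++⁺ (All.tabulate rank-R) (rank-N ∷ []))
  where
  N = suc (length (1 ∷ R))
  rank-R : ∀ {u} → u ∈ R → rank (R ∷ʳ N) u ≡ pred u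
  rank-R {u} u∈R = begin
    suc (countBelow u (R ++ [ N ]))            ≡⟨ cong suc (countBelow-++ u R [ N ]) ⟩
    suc (countBelow u R + countBelow u [ N ])  ≡⟨ cong (λ b → suc (countBelow u R + (indicator b + 0))) N≮u ⟩
    suc (countBelow u R + 0)                   ≡⟨ cong suc (+-identityʳ _) ⟩
    suc (countBelow u R)                       ≡⟨ cong (λ b → indicator b + countBelow u R) (<ᵇ-true 1<u) ⟨
    indicator (1 <ᵇ u) + countBelow u R        ≡⟨ cong pred (Standard-rank std (there u∈R)) ⟩
    pred u                                     ∎
    where
    open ≡-Reasoning
    N≮u : (N <ᵇ u) ≡ false
    N≮u = <ᵇ-false (<⇒≯ (s≤s (Standard-≤length std (there u∈R))))
    1<u : 1 < u
    1<u = ≤∧≢⇒< (Standard-positive std (there u∈R)) (All.lookup (AllPairs.head (proj₁ std)) u∈R)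
  rank-N : rank (R ∷ʳ N) N ≡ pred N
  rank-N rewrite countBelow-++ N R [ N ] | n<ᵇn≡false N
    | countBelow-maximum {N} {R} (All.tabulate λ u∈R → s≤s (Standard-≤length std (there u∈R)))
    = cong suc (+-identityʳ _)

measure-right : ∀ {y} L R → Standard y → isIdentity y ≡ false → y ≡ L ++ 1 ∷ R →
                measure (st (R ∷ʳ suc (length y))) < measure y
measure-right [] R std nonId refl with idPrefixLength 2 R <? length R
... | yes lt = begin-strict
  measure (st Rᴺ)                                     ≡⟨ cong₂ _+_ (cong (λ m → m * m) length-st) idPrefix-st ⟩
  n * n + idPrefixLength 2 R                          <⟨ +-monoʳ-< (n * n) (n<1+n _) ⟩
  measure (1 ∷ R)                                     ∎
  where
  open ≤-Reasoning
  n = length (1 ∷ R)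
  Rᴺ = R ∷ʳ suc n
  length-st : length (st Rᴺ) ≡ n
  length-st = trans (length-map _ Rᴺ) (trans (length-++ R) (+-comm (length R) 1))
  idPrefix-st : idPrefixLength 1 (st Rᴺ) ≡ idPrefixLength 2 R
  idPrefix-st = begin-equality
    idPrefixLength 1 (st Rᴺ)        ≡⟨ cong (idPrefixLength 1) (st-standard-tail std) ⟩
    idPrefixLength 1 (map pred Rᴺ)  ≡⟨ idPrefixLength-pred 1 (All.++⁺ (All.tabulate (Standard-positive std ∘ there)) (z<s ∷ [])) ⟩
    idPrefixLength 2 Rᴺ             ≡⟨ idPrefixLength-++ 2 R _ lt ⟩
    idPrefixLength 2 R              ∎
... | no ¬lt = contradiction (trans (sym (Equivalence.to T-≡ (subst (T ∘ eqList (1 ∷ R)) identity (eqList-refl (1 ∷ R))))) nonId) λ ()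
  where
  identity : 1 ∷ R ≡ idWord (length (1 ∷ R))
  identity = trans (idPrefixLength-full 0 (1 ∷ R) (cong suc (≤-antisym (idPrefixLength≤length 2 R) (≮⇒≥ ¬lt))))
                   (map-id (idWord (length (1 ∷ R))))
measure-right (x ∷ L) R std nonId refl = <-≤-trans (measure-shorter {st (R ∷ʳ suc n)} shorter) (m≤m+n (n * n) _)
  where
  n = length (x ∷ L ++ 1 ∷ R)
  shorter : length (st (R ∷ʳ suc n)) < n
  shorter rewrite length-map (rank (R ∷ʳ suc n)) (R ∷ʳ suc n) | length-++ R {[ suc n ]} | length-++ L {1 ∷ R}
    = s≤s (≤-trans (≤-reflexive (+-comm (length R) 1)) (m≤n+m _ (length L)))

Stable : ℕ → Set
Stable k = ∀ {y} → Standard y → measure y ≤ k → wF k y ≡ wF (suc k) y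

recurse-stable : ∀ k → Stable k → ∀ {y} → Standard y → measure y ≤ suc k → isIdentity y ≡ false →
                 recurse k y ≡ recurse (suc k) y
recurse-stable k stable {[]}     _   _  ()
recurse-stable k stable {v ∷ ys} std le nonId with Unique-split (proj₁ std) (Standard-∋1 std (here refl))
... | L , R , y≡ , 1∉L = begin
  recurse k y                          ≡⟨ recurse-split k L R 1∉L y≡ ⟩
  cost k Rᴺ + blockSum k L             ≡⟨ cong₂ _+_ (cong (_+ des Rᴺ) stable-R) (cong sum (map-cong-local (All.tabulate stable-block))) ⟩
  cost (suc k) Rᴺ + blockSum (suc k) L ≡⟨ recurse-split (suc k) L R 1∉L y≡ ⟨
  recurse (suc k) y                    ∎
  where
  open ≡-Reasoning
  y = v ∷ ys
  Rᴺ = R ∷ʳ suc (length y)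
  below : ∀ {m} → m < measure y → m ≤ k
  below lt = ≤-pred (≤-trans lt le)
  stable-R : wF k (st Rᴺ) ≡ wF (suc k) (st Rᴺ)
  stable-R = stable (Standard-st (Standard-right-unique L R std y≡)) (below (measure-right L R std nonId y≡))
  L<y : length L < length y
  L<y = subst (length L <_) (sym (trans (cong length y≡) (length-++ L))) (m<m+n (length L) z<s)
  stable-block : ∀ {bl} → bl ∈ blocks L → cost k bl ≡ cost (suc k) bl
  stable-block {bl} bl∈ = cong (_+ des bl) (stable
    (Standard-st (Unique-blocks (AllPairs-++⁻ˡ L (subst Unique y≡ (proj₁ std))) bl∈))
    (below (<-≤-trans (measure-shorter {st bl} (≤-<-trans (≤-reflexive (length-map _ bl)) (≤-<-trans (length-blocks bl∈) L<y)))
                      (m≤m+n _ _))))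

wF-stable : ∀ k → Stable k
wF-stable zero    {[]}    _   _  = refl
wF-stable zero    {_ ∷ _} _   ()
wF-stable (suc k) {y}     std le = if-∨-congʳ (recurse-stable k (wF-stable k) std le)

wF-stable-+ : ∀ d {k y} → Standard y → measure y ≤ k → wF k y ≡ wF (d + k) y
wF-stable-+ zero    std le = refl
wF-stable-+ (suc d) std le = trans (wF-stable-+ d std le) (wF-stable (d + _) std (≤-trans le (m≤n+m _ d)))

wF-stable-≤ : ∀ {k k′ y} → Standard y → measure y ≤ k → k ≤ k′ → wF k y ≡ wF k′ y
wF-stable-≤ {k} {k′} std le k≤k′ = trans (wF-stable-+ (k′ ∸ k) std le) (cong (λ j → wF j _) (m∸n+n≡m k≤k′))

lemma6p7 : (n : ℕ) → 2 ≤ n → (σ : List ℕ) (a b : ℕ)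
    → (σ ++ a ∷ b ∷ []) ↭ idWord n
    → a < b
    → w (st (σ ++ a ∷ [])) ≡ w (σ ++ a ∷ b ∷ [])
lemma6p7 n _ σ a b perm a<b = begin
  wF K′ (st x)  ≡⟨ wF-stable-≤ (Standard-st-init std) measure-st K′≤K ⟩
  wF K (st x)   ≡⟨ dropLastAscent K std (LastBelow-∷ʳ a<b) ⟩
  wF K (x ∷ʳ b) ≡⟨ cong (wF K) (++-assoc σ [ a ] [ b ]) ⟩
  wF K π        ∎
  where
  open ≡-Reasoning
  x = σ ∷ʳ a
  π = σ ++ a ∷ b ∷ []
  m = length (st x)
  K = suc (length π) * suc (length π)
  K′ = suc m * suc m
  std : Standard (x ∷ʳ b)
  std = subst Standard (sym (++-assoc σ [ a ] [ b ])) (↭-idWord⇒Standard perm)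
  measure-st : measure (st x) ≤ K′
  measure-st = <⇒≤ (≤-<-trans (measure≤ (st x)) (square-bound (n<1+n m)))
  m≤π : m ≤ length π
  m≤π rewrite length-map (rank x) x | length-++ σ {a ∷ b ∷ []} | length-++ σ {[ a ]} = +-monoʳ-≤ (length σ) (n≤1+n 1)
  K′≤K : K′ ≤ K
  K′≤K = *-mono-≤ (s≤s m≤π) (s≤s m≤π)
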